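{- For every positive integer $n$ and every red/blue coloring of the edges of the ordered complete graph $K_n$, there is a monochromatic complete interval minor of size (at least) $2^{\sqrt{\log n}-1}$.
   Context: $\log$ denotes the logarithm in base $2$. The ordered complete graph $K_n$ has vertex set $\{1,\dots,n\}$ with the natural order and all edges. Given a red/blue coloring of its edges, a red (resp. blue) complete interval minor of size $s$ is a partition of $\{1,\dots,n\}$ into $s$ nonempty intervals (sets of consecutive integers) such that between any two of these intervals there is a red (resp. blue) edge; a monochromatic complete interval minor is a red or a blue one. -}

module Defs where

open import Data.Nat using (ℕ; zero; suc; _+_; _*_; _^_; _≤_; _<_)
open import Data.Fin using (Fin; toℕ; fromℕ; inject₁)
open import Data.Product using (Σ; ∃; _×_; _,_)
open import Relation.Binary.PropositionalEquality using (_≡_)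

data Color : Set where
  red blue : Color

-- A red/blue coloring of the ordered complete graph on vertices {0,…,n-1}
-- (the paper's {1,…,n} shifted by one): the edge {i,j} with i < j gets color c i j.
-- Values c i j with i ≥ j or j ≥ n are irrelevant.
Coloring : Set
Coloring = ℕ → ℕ → Color

record IntervalPartition (n s : ℕ) : Set where
  field
    cut       : Fin (suc s) → ℕ
    cut-start : cut Fin.zero ≡ 0
    cut-end   : cut (fromℕ s) ≡ n
    cut-incr  : (k : Fin s) → cut (inject₁ k) < cut (Fin.suc k)

  InInterval : Fin s → ℕ → Set
  InInterval k v = (cut (inject₁ k) ≤ v) × (v < cut (Fin.suc k))

CompleteIntervalMinor : (c : Coloring) (n : ℕ) (col : Color) (s : ℕ) → Set
CompleteIntervalMinor c n col s =
  Σ (IntervalPartition n s) λ P →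
    let open IntervalPartition P in
    (k l : Fin s) → toℕ k < toℕ l →
      ∃ λ i → ∃ λ j → InInterval k i × InInterval l j × (c i j ≡ col)

-- s ≥ 2^(√(log₂ n) − 1), i.e. √(log₂ n) ≤ log₂ (2s), expressed without reals:
-- every nonnegative rational a/b (b > 0) with a/b < √(log₂ n)
-- (⇔ 2^(a²) < n^(b²)) satisfies a/b ≤ log₂(2s) (⇔ 2^a ≤ (2s)^b).
SizeBound : (n s : ℕ) → Set
SizeBound n s = (a b : ℕ) → 0 < b → 2 ^ (a * a) < n ^ (b * b) → 2 ^ a ≤ (2 * s) ^ b

-- Fix t ≥ 1. By induction on j, every interval of length t^j carries a red minor of size 2^j or a
-- blue minor of size t: cut an interval of length t^(j+1) into t blocks of length t^j. If some block
-- has a blue minor of size t we are done. Otherwise every block has a red minor of size 2^j; if two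
-- blocks are joined only by red edges, their red minors concatenate to one of size 2^(j+1), and if
-- not, any two blocks are joined by a blue edge and the blocks themselves form a blue minor of size t.
-- With t = 2^k and j = k this gives a monochromatic minor of size 2^k as soon as 2^(k²) ≤ n, and
-- choosing k maximal yields n < 2^((k+1)²), that is 2^k > 2^(√(log n) − 1).
module Submission where

open import Defs
open import Data.Nat using (ℕ; zero; suc; >-nonZero; _+_; _*_; _∸_; _^_; _≤_; _<_; z≤n; s≤s; z<s; s<s; _≟_; _≤?_; _<?_)
open import Data.Nat.Properties
open import Data.Product using (∃; _×_; _,_; Σ; proj₁; proj₂)
open import Data.Sum using (_⊎_; inj₁; inj₂; [_,_]′; swap)
import Data.Sum as Sum
open import Data.Fin using (Fin; toℕ; fromℕ; inject₁)
open import Data.Fin.Properties using (toℕ-inject₁; toℕ-fromℕ; toℕ<n)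
open import Function using (_∘_)
open import Relation.Binary.PropositionalEquality
open import Relation.Nullary using (yes; no; ¬_; contradiction)
open import Relation.Unary using (Decidable)

private
  variable
    c : Coloring
    col : Color
    a b a′ b′ i k s r n : ℕ

Interval : Set
Interval = ℕ × ℕ

_∈_ : ℕ → Interval → Set
i ∈ I = proj₁ I ≤ i × i < proj₂ I

_⊑_ : Interval → Interval → Set
I ⊑ J = proj₁ J ≤ proj₁ I × proj₂ I ≤ proj₂ J

∈-⊑ : ∀ {I J} → i ∈ I → I ⊑ J → i ∈ J
∈-⊑ (lo≤i , i<hi) (lo′≤lo , hi≤hi′) = ≤-trans lo′≤lo lo≤i , <-≤-trans i<hi hi≤hi′

nonempty-⊑ : ∀ {I J} → I ⊑ J → proj₁ I < proj₂ I → proj₁ J < proj₂ J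
nonempty-⊑ (lo′≤lo , hi≤hi′) lo<hi = ≤-<-trans lo′≤lo (<-≤-trans lo<hi hi≤hi′)

block : (ℕ → ℕ) → ℕ → Interval
block cut k = cut k , cut (suc k)

∈-suc : i ∈ (a , suc b) → i ∈ (a , b) ⊎ (a ≤ b × i ≡ b)
∈-suc (a≤i , i<1+b) with m<1+n⇒m<n∨m≡n i<1+b
... | inj₁ i<b = inj₁ (a≤i , i<b)
... | inj₂ refl = inj₂ (a≤i , refl)

search : ∀ {A B : ℕ → Set} → (∀ i → A i ⊎ B i) → ∀ I →
  (∃ λ i → i ∈ I × A i) ⊎ (∀ i → i ∈ I → B i)
search d (a , zero) = inj₂ λ _ ()
search d (a , suc b) with search d (a , b)
... | inj₁ (i , (a≤i , i<b) , x) = inj₁ (i , (a≤i , m<n⇒m<1+n i<b) , x)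
... | inj₂ below with d b
...   | inj₂ y = inj₂ λ i i∈ → [ below i , (λ { (_ , refl) → y }) ]′ (∈-suc i∈)
...   | inj₁ x with a ≤? b
...     | yes a≤b = inj₁ (b , (a≤b , n<1+n b) , x)
...     | no a≰b = inj₂ λ i i∈ → [ below i , (λ (a≤b , _) → contradiction a≤b a≰b) ]′ (∈-suc i∈)

Edge : Coloring → Color → Interval → Interval → Set
Edge c col I J = ∃ λ i → i ∈ I × ∃ λ j → j ∈ J × c i j ≡ col

AllEdges : Coloring → Color → Interval → Interval → Set
AllEdges c col I J = ∀ i → i ∈ I → ∀ j → j ∈ J → c i j ≡ col

Edge-⊑ : ∀ {I I′ J J′} → I ⊑ I′ → J ⊑ J′ → Edge c col I J → Edge c col I′ J′
Edge-⊑ I⊑I′ J⊑J′ (i , i∈I , j , j∈J , e) = i , ∈-⊑ i∈I I⊑I′ , j , ∈-⊑ j∈J J⊑J′ , e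

AllEdges⇒Edge : ∀ {I J I′ J′} → AllEdges c col I′ J′ →
  proj₁ I < proj₂ I → I ⊑ I′ → proj₁ J < proj₂ J → J ⊑ J′ → Edge c col I J
AllEdges⇒Edge {I = I} {J} all I≠∅ I⊑I′ J≠∅ J⊑J′ =
  proj₁ I , (≤-refl , I≠∅) , proj₁ J , (≤-refl , J≠∅) ,
  all _ (∈-⊑ (≤-refl , I≠∅) I⊑I′) _ (∈-⊑ (≤-refl , J≠∅) J⊑J′)

blue-or-red : ∀ x → x ≡ blue ⊎ x ≡ red
blue-or-red red = inj₂ refl
blue-or-red blue = inj₁ refl

blueEdge-or-allRed : ∀ c I J → Edge c blue I J ⊎ AllEdges c red I J
blueEdge-or-allRed c I J = search (λ i → search (λ j → blue-or-red (c i j)) J) I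

-- Unlike an interval partition, the blocks [cut k, cut (k+1)), k < s, of a minor need not cover I.

record Minor (c : Coloring) (col : Color) (I : Interval) (s : ℕ) : Set where
  field
    cut      : ℕ → ℕ
    lower    : proj₁ I ≤ cut 0
    upper    : cut s ≤ proj₂ I
    cut-incr : ∀ {k} → k < s → cut k < cut (suc k)
    edges    : ∀ {k l} → k < l → l < s → Edge c col (block cut k) (block cut l)

  cut-mono : ∀ {k l} → k ≤ l → l ≤ s → cut k ≤ cut l
  cut-mono {l = zero} z≤n _ = ≤-refl
  cut-mono {k} {suc l} k≤1+l 1+l≤s with m≤n⇒m<n∨m≡n k≤1+l
  ... | inj₁ (s≤s k≤l) = ≤-trans (cut-mono k≤l (<⇒≤ 1+l≤s)) (<⇒≤ (cut-incr 1+l≤s))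
  ... | inj₂ refl = ≤-refl

  block-⊑ : ∀ {k} → k < s → block cut k ⊑ I
  block-⊑ k<s = ≤-trans lower (cut-mono z≤n (<⇒≤ k<s)) , ≤-trans (cut-mono k<s ≤-refl) upper

open Minor

singleton : a < b → Minor c col (a , b) 1
singleton {a} {b} a<b = record
  { cut = λ { zero → a ; (suc _) → b }
  ; lower = ≤-refl ; upper = ≤-refl
  ; cut-incr = λ { {zero} _ → a<b ; {suc _} (s≤s ()) }
  ; edges = λ { {l = zero} () _ ; {l = suc _} _ (s≤s ()) } }

enlarge : ∀ {I J} (M : Minor c col I s) (F : ℕ → ℕ) → proj₁ J ≤ F 0 → F s ≤ proj₂ J →
  (∀ {k} → k < s → block (cut M) k ⊑ block F k) → Minor c col J s
enlarge M F lower upper grows = record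
  { cut = F ; lower = lower ; upper = upper
  ; cut-incr = λ k<s → nonempty-⊑ (grows k<s) (cut-incr M k<s)
  ; edges = λ k<l l<s → Edge-⊑ (grows (<-trans k<l l<s)) (grows l<s) (edges M k<l l<s) }

weaken : ∀ {I J} → I ⊑ J → Minor c col I s → Minor c col J s
weaken (lo′≤lo , hi≤hi′) M =
  enlarge M (cut M) (≤-trans lo′≤lo (lower M)) (≤-trans (upper M) hi≤hi′) (λ _ → ≤-refl , ≤-refl)

splice : ℕ → (ℕ → ℕ) → (ℕ → ℕ) → ℕ → ℕ
splice zero f g k = g k
splice (suc s) f g zero = f zero
splice (suc s) f g (suc k) = splice s (f ∘ suc) g k

splice-start : ∀ s f g → f s ≤ g 0 → f 0 ≤ splice s f g 0
splice-start zero f g f0≤g0 = f0≤g0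
splice-start (suc s) f g _ = ≤-refl

splice-⊑ˡ : ∀ s f g → f s ≤ g 0 → k < s → block f k ⊑ block (splice s f g) k
splice-⊑ˡ {zero} (suc zero) f g f1≤g0 _ = ≤-refl , f1≤g0
splice-⊑ˡ {zero} (suc (suc s)) f g _ _ = ≤-refl , ≤-refl
splice-⊑ˡ {suc k} (suc s) f g fs≤g0 (s≤s k<s) = splice-⊑ˡ s (f ∘ suc) g fs≤g0 k<s

splice-⊑ʳ : ∀ s f g j → block g j ⊑ block (splice s f g) (s + j)
splice-⊑ʳ zero f g j = ≤-refl , ≤-refl
splice-⊑ʳ (suc s) f g j = splice-⊑ʳ s (f ∘ suc) g j

splice-end : ∀ s f g j → splice s f g (s + j) ≡ g j
splice-end zero f g j = refl
splice-end (suc s) f g j = splice-end s (f ∘ suc) g j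

left-or-right : ∀ s k → k < s ⊎ ∃ λ j → s + j ≡ k
left-or-right s k with k <? s
... | yes k<s = inj₁ k<s
... | no k≮s = inj₂ (k ∸ s , m+[n∸m]≡n (≮⇒≥ k≮s))

concat : Minor c col (a , b) s → Minor c col (a′ , b′) r → b ≤ a′ → AllEdges c col (a , b) (a′ , b′) →
  Minor c col (a , b′) (s + r)
concat {c = c} {col = col} {s = s} {r = r} P Q b≤a′ joined = record
  { cut = F
  ; lower = ≤-trans (lower P) (splice-start s f g P≤Q)
  ; upper = ≤-trans (≤-reflexive (splice-end s f g r)) (upper Q)
  ; cut-incr = incr
  ; edges = edges′ }
  where
  f = cut P
  g = cut Q
  F = splice s f g

  P≤Q : f s ≤ g 0
  P≤Q = ≤-trans (upper P) (≤-trans b≤a′ (lower Q))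

  left : k < s → block f k ⊑ block F k
  left = splice-⊑ˡ s f g P≤Q

  right : ∀ j → block g j ⊑ block F (s + j)
  right = splice-⊑ʳ s f g

  incr : ∀ {k} → k < s + r → F k < F (suc k)
  incr {k} k<s+r with left-or-right s k
  ... | inj₁ k<s = nonempty-⊑ (left k<s) (cut-incr P k<s)
  ... | inj₂ (j , refl) = nonempty-⊑ (right j) (cut-incr Q (+-cancelˡ-< s j r k<s+r))

  edges′ : ∀ {k l} → k < l → l < s + r → Edge c col (block F k) (block F l)
  edges′ {k} {l} k<l l<s+r with left-or-right s k | left-or-right s l
  ... | inj₁ k<s | inj₁ l<s = Edge-⊑ (left k<s) (left l<s) (edges P k<l l<s)
  ... | inj₁ k<s | inj₂ (j , refl) =
    Edge-⊑ (left k<s) (right j)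
      (AllEdges⇒Edge joined (cut-incr P k<s) (block-⊑ P k<s) (cut-incr Q j<r) (block-⊑ Q j<r))
    where j<r = +-cancelˡ-< s j r l<s+r
  ... | inj₂ (i , refl) | inj₁ l<s = contradiction (≤-trans (m≤m+n s i) (<⇒≤ k<l)) (<⇒≱ l<s)
  ... | inj₂ (i , refl) | inj₂ (j , refl) =
    Edge-⊑ (right i) (right j) (edges Q (+-cancelˡ-< s i j k<l) (+-cancelˡ-< s j r l<s+r))

module Blocks (M lo : ℕ) where

  bd : ℕ → ℕ
  bd p = p * M + lo

  bd-mono : ∀ {p q} → p ≤ q → bd p ≤ bd q
  bd-mono p≤q = +-monoˡ-≤ lo (*-monoˡ-≤ M p≤q)

  block-length : ∀ p → M + bd p ≡ bd (suc p)
  block-length p = sym (+-assoc M (p * M) lo)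

  span-⊑ : ∀ p {q t} → q < t → (bd p , bd (suc q)) ⊑ (lo , bd t)
  span-⊑ p q<t = bd-mono {q = p} z≤n , bd-mono q<t

  blocks-minor : ∀ {t} → 0 < M →
    (∀ q → q ∈ (0 , t) → ∀ p → p ∈ (0 , q) → Edge c col (block bd p) (block bd q)) →
    Minor c col (lo , bd t) t
  blocks-minor M>0 joined = record
    { cut = bd ; lower = ≤-refl ; upper = ≤-refl
    ; cut-incr = λ {k} _ → <-≤-trans (m<n+m (bd k) M>0) (≤-reflexive (block-length k))
    ; edges = λ k<l l<t → joined _ (z≤n , l<t) _ (z≤n , k<l) }

module _ (c : Coloring) {t : ℕ} (t>0 : 0 < t) where

  RedOrBlue : ℕ → Interval → Set
  RedOrBlue j I = Minor c red I (2 ^ j) ⊎ Minor c blue I t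

  module Step (j lo : ℕ) (ih : ∀ lo hi → t ^ j + lo ≤ hi → RedOrBlue j (lo , hi)) where
    open Blocks (t ^ j) lo

    in-block : ∀ p → RedOrBlue j (block bd p)
    in-block p = ih (bd p) (bd (suc p)) (≤-reflexive (block-length p))

    double : 2 ^ j + 2 ^ j ≡ 2 ^ suc j
    double = cong (2 ^ j +_) (sym (+-identityʳ (2 ^ j)))

    step : RedOrBlue (suc j) (lo , bd t)
    step with search (swap ∘ in-block) (0 , t)
    ... | inj₁ (p , (_ , p<t) , blue-minor) = inj₂ (weaken (span-⊑ p p<t) blue-minor)
    ... | inj₂ all-red
      with search (λ q → search (λ p → swap (blueEdge-or-allRed c (block bd p) (block bd q))) (0 , q)) (0 , t)
    ...   | inj₁ (q , (_ , q<t) , p , (_ , p<q) , joined) =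
      inj₁ (subst (Minor c red _) double (weaken (span-⊑ p q<t)
        (concat (all-red p (z≤n , <-trans p<q q<t)) (all-red q (z≤n , q<t))
                (bd-mono {q = q} p<q) joined)))
    ...   | inj₂ blue-edges = inj₂ (blocks-minor (m^n>0 t {{>-nonZero t>0}} j) blue-edges)

  red-or-blue-minor : ∀ j lo hi → t ^ j + lo ≤ hi → RedOrBlue j (lo , hi)
  red-or-blue-minor zero lo hi lo<hi = inj₁ (singleton lo<hi)
  red-or-blue-minor (suc j) lo hi fits =
    Sum.map (weaken (≤-refl , fits)) (weaken (≤-refl , fits)) (Step.step j lo (red-or-blue-minor j))

pin-ends : ℕ → ℕ → ℕ → (ℕ → ℕ) → ℕ → ℕ
pin-ends lo hi s f zero = lo
pin-ends lo hi s f (suc k) with suc k ≟ s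
... | yes _ = hi
... | no _ = f (suc k)

pin-ends-end : ∀ lo hi s f → pin-ends lo hi (suc s) f (suc s) ≡ hi
pin-ends-end lo hi s f with suc s ≟ suc s
... | yes _ = refl
... | no s≢s = contradiction refl s≢s

stretch : ∀ {lo hi} (M : Minor c col (lo , hi) (suc s)) →
  Σ (Minor c col (lo , hi) (suc s)) λ M′ → cut M′ 0 ≡ lo × cut M′ (suc s) ≡ hi
stretch {s = s} {lo} {hi} M =
  enlarge M F ≤-refl (≤-reflexive F-end) (λ k<s → pinned-start k<s , pinned-end k<s) , refl , F-end
  where
  F = pin-ends lo hi (suc s) (cut M)

  F-end : F (suc s) ≡ hi
  F-end = pin-ends-end lo hi s (cut M)

  pinned-start : k < suc s → F k ≤ cut M k
  pinned-start {zero} _ = lower M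
  pinned-start {suc k} k<s with suc k ≟ suc s
  ... | yes refl = contradiction k<s (<-irrefl refl)
  ... | no _ = ≤-refl

  pinned-end : k < suc s → cut M (suc k) ≤ F (suc k)
  pinned-end {k} _ with suc k ≟ suc s
  ... | yes refl = upper M
  ... | no _ = ≤-refl

exact⇒CompleteIntervalMinor : (M : Minor c col (0 , n) s) → cut M 0 ≡ 0 → cut M s ≡ n →
  CompleteIntervalMinor c n col s
exact⇒CompleteIntervalMinor {c = c} {col = col} {s = s} M start end =
  record
    { cut = f ∘ toℕ
    ; cut-start = start
    ; cut-end = trans (cong f (toℕ-fromℕ s)) end
    ; cut-incr = λ k →
        subst (λ m → f m < f (suc (toℕ k))) (sym (toℕ-inject₁ k)) (cut-incr M (toℕ<n k)) }
  , λ k l k<l → reindex (edges M k<l (toℕ<n l))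
  where
  f = cut M

  in-block : ∀ (k : Fin s) {v} → v ∈ block f (toℕ k) → f (toℕ (inject₁ k)) ≤ v × v < f (suc (toℕ k))
  in-block k (≤v , v<) = subst (λ m → f m ≤ _) (sym (toℕ-inject₁ k)) ≤v , v<

  reindex : ∀ {k l} → Edge c col (block f (toℕ k)) (block f (toℕ l)) →
    ∃ λ i → ∃ λ j → (f (toℕ (inject₁ k)) ≤ i × i < f (suc (toℕ k))) ×
                    (f (toℕ (inject₁ l)) ≤ j × j < f (suc (toℕ l))) × c i j ≡ col
  reindex {k} {l} (i , i∈ , j , j∈ , e) = i , j , in-block k i∈ , in-block l j∈ , e

Minor⇒CompleteIntervalMinor : 0 < s → Minor c col (0 , n) s → CompleteIntervalMinor c n col s
Minor⇒CompleteIntervalMinor {suc s} _ M =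
  let M′ , start , end = stretch M in exact⇒CompleteIntervalMinor M′ start end

last-before : ∀ {P : ℕ → Set} → Decidable P → P 0 → ∀ N → ¬ P N → ∃ λ k → P k × ¬ P (suc k)
last-before P? P0 zero ¬P0 = contradiction P0 ¬P0
last-before P? P0 (suc N) ¬PN with P? N
... | yes PN = N , PN , ¬PN
... | no ¬PN-1 = last-before P? P0 N ¬PN-1

n<2^n : ∀ n → n < 2 ^ n
n<2^n zero = z<s
n<2^n (suc n) = ≤-<-trans (n<2^n n) (^-monoʳ-< 2 (s<s z<s) (n<1+n n))

sqrt-log-bracket : ∀ n → 1 ≤ n → ∃ λ k → 2 ^ (k * k) ≤ n × n < 2 ^ (suc k * suc k)
sqrt-log-bracket n 1≤n =
  let k , lower , ¬upper = last-before (λ k → 2 ^ (k * k) ≤? n) 1≤n n (<⇒≱ n<2^[n*n])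
  in k , lower , ≰⇒> ¬upper
  where
  n<2^[n*n] : n < 2 ^ (n * n)
  n<2^[n*n] = <-≤-trans (n<2^n n) (^-monoʳ-≤ 2 (m≤m*n n n {{>-nonZero 1≤n}}))

sizeBound : ∀ {n} k → n ≤ 2 ^ (suc k * suc k) → SizeBound n (2 ^ k)
sizeBound {n} k n≤2^K² a b _ 2^a²<n^b² = begin
  2 ^ a        ≤⟨ ^-monoʳ-≤ 2 a≤Kb ⟩
  2 ^ (K * b)  ≡⟨ sym (^-*-assoc 2 K b) ⟩
  (2 ^ K) ^ b  ∎
  where
  open ≤-Reasoning
  K = suc k

  a≤Kb : a ≤ K * b
  a≤Kb = ≮⇒≥ λ Kb<a → <⇒≱ 2^a²<n^b² (begin
    n ^ (b * b)              ≤⟨ ^-monoˡ-≤ (b * b) n≤2^K² ⟩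
    (2 ^ (K * K)) ^ (b * b)  ≡⟨ ^-*-assoc 2 (K * K) (b * b) ⟩
    2 ^ (K * K * (b * b))    ≡⟨ cong (2 ^_) ([m*n]*[o*p]≡[m*o]*[n*p] K K b b) ⟩
    2 ^ (K * b * (K * b))    ≤⟨ ^-monoʳ-≤ 2 (*-mono-≤ (<⇒≤ Kb<a) (<⇒≤ Kb<a)) ⟩
    2 ^ (a * a)              ∎)

monochromatic : ∀ {I} → Minor c red I s ⊎ Minor c blue I s → ∃ λ col → Minor c col I s
monochromatic = [ (red ,_) , (blue ,_) ]′

lemma24 : (n : ℕ) → 1 ≤ n → (c : Coloring) →
    ∃ λ col → ∃ λ s → SizeBound n s × CompleteIntervalMinor c n col s
lemma24 n 1≤n c =
  let k , 2^k²≤n , n<2^K² = sqrt-log-bracket n 1≤n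
      fits = subst (_≤ n) (sym (trans (+-identityʳ _) (^-*-assoc 2 k k))) 2^k²≤n
      col , M = monochromatic (red-or-blue-minor c (m^n>0 2 k) k 0 n fits)
  in col , 2 ^ k , sizeBound k (<⇒≤ n<2^K²) , Minor⇒CompleteIntervalMinor (m^n>0 2 k) M
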